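{- Let $G$ be a finite group and $H$ a subgroup of $G$. Let $\Gamma$ be the graph whose vertex set is the set $[G{:}H]$ of right cosets of $H$ in $G$, where distinct cosets $Hx\neq Hy$ are adjacent iff $y\in Hx^{ -1}H$. For $x\in G$, let $\Gamma_x$ be the subgraph of $\Gamma$ induced on the set of right cosets of $H$ contained in $HxH\cup Hx^{ -1}H$, and let $m=|H|/|H\cap H^x|$. If $HxH=Hx^{ -1}H$, then $\Gamma_x$ is the complete graph $K_m$. If $HxH\neq Hx^{ -1}H$, then $\Gamma_x$ is the complete bipartite graph $K_{m,m}$.
   Context: $H^x=x^{ -1}Hx$. The adjacency relation on right cosets is well defined and symmetric. -}

module Defs where

open import Level using (Level; _⊔_) renaming (suc to lsuc)
open import Algebra.Bundles using (Group)
open import Data.Nat using (ℕ)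
open import Data.Fin using (Fin)
open import Data.List using (length; filter; allFin)
open import Data.Product using (Σ; ∃; ∃-syntax; _×_; _,_; proj₁)
open import Data.Sum using (_⊎_; inj₁; inj₂)
open import Data.Unit using (⊤)
open import Data.Empty using (⊥)
open import Function.Bundles using (_⇔_)
open import Relation.Nullary using (¬_; Dec)
open import Relation.Unary using (Pred; Decidable)
open import Relation.Binary.PropositionalEquality using (_≡_)

record FiniteGroup (c ℓ : Level) : Set (lsuc (c ⊔ ℓ)) where
  field
    group     : Group c ℓ
  open Group group public
  field
    order     : ℕ
    enum      : Fin order → Carrier
    enum-inj  : ∀ i j → enum i ≈ enum j → i ≡ j
    enum-surj : ∀ g → ∃[ i ] (enum i ≈ g)

record Subgroup {c ℓ} (G : FiniteGroup c ℓ) (p : Level) : Set (c ⊔ ℓ ⊔ lsuc p) where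
  open FiniteGroup G
  field
    _∈H        : Pred Carrier p
    resp       : ∀ {g h} → g ≈ h → g ∈H → h ∈H
    ε∈         : ε ∈H
    ∙-closed   : ∀ {g h} → g ∈H → h ∈H → (g ∙ h) ∈H
    ⁻¹-closed  : ∀ {g} → g ∈H → (g ⁻¹) ∈H
    dec        : Decidable _∈H

module _ {c ℓ p} (G : FiniteGroup c ℓ) (H : Subgroup G p) where
  open FiniteGroup G
  open Subgroup H

  card : ∀ {q} {P : Pred Carrier q} → Decidable P → ℕ
  card P? = length (filter (λ i → P? (enum i)) (allFin order))

  ∣H∣ : ℕ
  ∣H∣ = card dec

  -- membership in H^x = x⁻¹ H x :  g ∈ x⁻¹Hx  iff  x g x⁻¹ ∈ H
  _∈H^_ : Carrier → Carrier → Set p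
  g ∈H^ x = (x ∙ g ∙ x ⁻¹) ∈H

  ∣H∩H^_∣ : Carrier → ℕ
  ∣H∩H^ x ∣ = card {P = λ g → g ∈H × g ∈H^ x}
                (λ g → dec' g)
    where
    open import Relation.Nullary.Decidable using (_×-dec_)
    dec' : ∀ g → Dec (g ∈H × g ∈H^ x)
    dec' g = dec g ×-dec dec (x ∙ g ∙ x ⁻¹)

  _∈H·_ : Carrier → Carrier → Set (c ⊔ ℓ ⊔ p)
  z ∈H· g = ∃[ h ] (h ∈H × z ≈ h ∙ g)

  _∈H·_·H : Carrier → Carrier → Set (c ⊔ ℓ ⊔ p)
  z ∈H· a ·H = ∃[ h₁ ] ∃[ h₂ ] (h₁ ∈H × h₂ ∈H × z ≈ h₁ ∙ a ∙ h₂)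

  SameCoset : Carrier → Carrier → Set (c ⊔ ℓ ⊔ p)
  SameCoset g g' = ∀ z → (z ∈H· g) ⇔ (z ∈H· g')

  SameDouble : Carrier → Carrier → Set (c ⊔ ℓ ⊔ p)
  SameDouble a b = ∀ z → (z ∈H· a ·H) ⇔ (z ∈H· b ·H)

  Adj : Carrier → Carrier → Set (c ⊔ ℓ ⊔ p)
  Adj g g' = ¬ SameCoset g g' × (g' ∈H· (g ⁻¹) ·H)

  VertΓ : Carrier → Set (c ⊔ ℓ ⊔ p)
  VertΓ x = Σ Carrier λ g → ∀ z → z ∈H· g → (z ∈H· x ·H) ⊎ (z ∈H· (x ⁻¹) ·H)

-- A graph isomorphism from a graph whose vertices are the classes of a type V
-- under an equivalence _~_ (adjacency Adj) onto a graph with vertex type T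
-- (adjacency AdjT): a map V → T that induces a bijection V/~ → T and
-- preserves and reflects adjacency.
record GraphIso {a b r s t} (V : Set a) (_~_ : V → V → Set b) (AdjV : V → V → Set r)
                (T : Set s) (AdjT : T → T → Set t) : Set (a ⊔ b ⊔ r ⊔ s ⊔ t) where
  field
    f        : V → T
    f-class  : ∀ u v → (f u ≡ f v) ⇔ (u ~ v)
    f-surj   : ∀ y → ∃[ v ] (f v ≡ y)
    f-adj    : ∀ u v → AdjV u v ⇔ AdjT (f u) (f v)

AdjK : ∀ m → Fin m → Fin m → Set
AdjK m i j = ¬ (i ≡ j)

AdjKmm : ∀ m → (Fin m ⊎ Fin m) → (Fin m ⊎ Fin m) → Set
AdjKmm m (inj₁ _) (inj₁ _) = ⊥
AdjKmm m (inj₁ _) (inj₂ _) = ⊤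
AdjKmm m (inj₂ _) (inj₁ _) = ⊤
AdjKmm m (inj₂ _) (inj₂ _) = ⊥

module _ {c ℓ p} (G : FiniteGroup c ℓ) (H : Subgroup G p) (x : FiniteGroup.Carrier G) where
  Γ_≅_ : ∀ {s t} (T : Set s) (AdjT : T → T → Set t) → Set _
  Γ_≅_ T AdjT = GraphIso (VertΓ G H x)
                    (λ u v → SameCoset G H (proj₁ u) (proj₁ v))
                    (λ u v → Adj G H (proj₁ u) (proj₁ v))
                    T AdjT

-- For g ∈ HyH choose h ∈ H with Hg = Hyh; then Hyh = Hyh' iff hh'⁻¹ ∈ H^y, so the right cosets inside HyH
-- correspond to the cosets of H ∩ H^y in H.  Splitting H into these classes, each of size |H ∩ H^y|, shows
-- that there are exactly m of them; as conjugation by x maps H ∩ H^x onto H ∩ H^(x⁻¹), the same m works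
-- for Hx⁻¹H.  For g ∈ HaH and g' ∈ HbH we have g' ∈ Hg⁻¹H iff b ∈ Ha⁻¹H.  Hence if HxH = Hx⁻¹H any two
-- distinct cosets of Γ_x are adjacent, while otherwise the two double cosets are disjoint and the edges of
-- Γ_x are exactly the pairs with one coset in each.

module Submission where

open import Defs
open import Data.Nat using (ℕ; _*_)
open import Data.Fin using (Fin)
open import Data.Sum using (_⊎_)
open import Data.Product using (_×_)
open import Relation.Nullary using (¬_)
open import Relation.Binary.PropositionalEquality using (_≡_)

open import Level using (Level; _⊔_; 0ℓ)
open import Algebra.Properties.CommutativeSemigroup using (interchange)
open import Data.Empty using (⊥; ⊥-elim)
open import Data.Fin using (zero; suc)
open import Data.Fin.Permutation using (Permutation′; _⟨$⟩ʳ_; permutation)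
open import Data.List using (List; []; _∷_; length; filter; tabulate; allFin; map; deduplicate)
open import Data.List.Properties using (filter-≐; filter-none; filter-some; map-cong)
open import Data.List.Relation.Unary.All as All using (All; []; _∷_)
import Data.List.Relation.Unary.All.Properties as Allₚ
open import Data.List.Relation.Unary.Any as Any using (here; there; index)
import Data.List.Relation.Unary.Unique.Setoid as Unique
open import Data.List.Relation.Unary.Unique.DecSetoid.Properties using (deduplicate-!)
import Data.List.Membership.Setoid as Membership
open import Data.List.Membership.Setoid.Properties
  using (∈-resp-≈; All[≉]⇒∉; index-injective; ∈-deduplicate⁺; ∈-lookup)
open import Data.List.Membership.Propositional using () renaming (_∈_ to _∈ₚ_)
open import Data.List.Membership.Propositional.Properties
  using () renaming (∈-filter⁺ to ∈ₚ-filter⁺; ∈-allFin to ∈ₚ-allFin; ∈-lookup to ∈ₚ-lookup)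
open import Data.Nat using (zero; suc; _+_; _<_; >-nonZero)
open import Data.Nat.ListAction using (sum)
open import Data.Nat.Properties using (+-0-commutativeMonoid; +-commutativeSemigroup; *-zeroʳ; *-cancelʳ-≡)
open import Data.Product using (Σ; ∃-syntax; _,_; proj₁; proj₂)
open import Data.Sum using (inj₁; inj₂; [_,_]′)
import Data.Sum as Sum
open import Data.Sum.Properties using (inj₁-injective; inj₂-injective)
open import Function using (_∘_; id)
open import Function.Bundles using (_⇔_; mk⇔; Equivalence)
open import Function.Construct.Composition using (_⇔-∘_)
open import Function.Construct.Symmetry using (⇔-sym)
open import Relation.Binary.Bundles using (DecSetoid)
open import Relation.Binary.Definitions using (_Respects_)
import Relation.Binary.PropositionalEquality as ≡
open import Relation.Nullary using (Dec; yes; no)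
open import Relation.Nullary.Decidable using (_×-dec_)
open import Relation.Unary using (Pred; Decidable; _≐_)
import Algebra.Properties.CommutativeMonoid.Sum +-0-commutativeMonoid as ∑

private
  variable
    a b p q : Level
    A : Set a
    B : Set b

indicator : {P : Set p} → Dec P → ℕ
indicator (yes _) = 1
indicator (no _)  = 0

indicator-yes : {P : Set p} (P? : Dec P) → P → indicator P? ≡ 1
indicator-yes (yes _) _ = ≡.refl
indicator-yes (no ¬p) p = ⊥-elim (¬p p)

indicator-no : {P : Set p} (P? : Dec P) → ¬ P → indicator P? ≡ 0
indicator-no (yes p) ¬p = ⊥-elim (¬p p)
indicator-no (no _)  _  = ≡.refl

sum-map-+ : (f g : B → ℕ) (rs : List B) →
            sum (map (λ r → f r + g r) rs) ≡ sum (map f rs) + sum (map g rs)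
sum-map-+ f g []       = ≡.refl
sum-map-+ f g (r ∷ rs) = ≡.trans (≡.cong (f r + g r +_) (sum-map-+ f g rs))
                                 (interchange +-commutativeSemigroup (f r) (g r) _ _)

sum-map-const : ∀ {k} (f : B → ℕ) {rs : List B} →
                All (λ r → f r ≡ k) rs → sum (map f rs) ≡ length rs * k
sum-map-const f []         = ≡.refl
sum-map-const f (fr ∷ frs) = ≡.cong₂ _+_ fr (sum-map-const f frs)

count : {P : Pred A p} → Decidable P → List A → ℕ
count P? xs = length (filter P? xs)

count-∷ : {P : Pred A p} (P? : Decidable P) → ∀ x xs →
          count P? (x ∷ xs) ≡ indicator (P? x) + count P? xs
count-∷ P? x xs with P? x
... | yes _ = ≡.refl
... | no _  = ≡.refl

count-as-sum : {P : Pred A p} (P? : Decidable P) → ∀ xs → count P? xs ≡ sum (map (indicator ∘ P?) xs)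
count-as-sum P? []       = ≡.refl
count-as-sum P? (x ∷ xs) =
  ≡.trans (count-∷ P? x xs) (≡.cong (indicator (P? x) +_) (count-as-sum P? xs))

count-tabulate : {P : Pred A p} (P? : Decidable P) → ∀ {n} (f : Fin n → A) →
                 count P? (tabulate f) ≡ ∑.sum (indicator ∘ P? ∘ f)
count-tabulate P? {zero}  f = ≡.refl
count-tabulate P? {suc n} f =
  ≡.trans (count-∷ P? (f zero) _) (≡.cong (indicator (P? (f zero)) +_) (count-tabulate P? (f ∘ suc)))

count-permute : ∀ {n} {P : Pred (Fin n) p} (P? : Decidable P) (π : Permutation′ n) →
                count P? (allFin n) ≡ count (P? ∘ (π ⟨$⟩ʳ_)) (allFin n)
count-permute P? π = ≡.trans (count-tabulate P? id)
  (≡.trans (∑.sum-permute _ π) (≡.sym (count-tabulate (P? ∘ (π ⟨$⟩ʳ_)) id)))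

count-partition : {P : Pred A p} (P? : Decidable P) {C : B → Pred A q} (C? : ∀ r → Decidable (C r))
                  (rs : List B) {xs : List A} →
                  All (λ x → count (λ r → C? r x) rs ≡ indicator (P? x)) xs →
                  count P? xs ≡ sum (map (λ r → count (C? r) xs) rs)
count-partition P? C? rs [] =
  ≡.sym (≡.trans (sum-map-const _ (All.universal (λ _ → ≡.refl) rs)) (*-zeroʳ (length rs)))
count-partition P? C? rs {x ∷ xs} (one ∷ ones) = begin
  count P? (x ∷ xs)
    ≡⟨ count-∷ P? x xs ⟩
  indicator (P? x) + count P? xs
    ≡⟨ ≡.cong₂ _+_ (≡.trans (≡.sym one) (count-as-sum (λ r → C? r x) rs)) (count-partition P? C? rs ones) ⟩
  sum (map (λ r → indicator (C? r x)) rs) + sum (map (λ r → count (C? r) xs) rs)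
    ≡⟨ sum-map-+ _ _ rs ⟨
  sum (map (λ r → indicator (C? r x) + count (C? r) xs) rs)
    ≡⟨ ≡.cong sum (map-cong (λ r → ≡.sym (count-∷ (C? r) x xs)) rs) ⟩
  sum (map (λ r → count (C? r) (x ∷ xs)) rs)
    ∎
  where open ≡.≡-Reasoning

module _ {ℓ} (S : DecSetoid a ℓ) where
  open DecSetoid S
  open Unique setoid using (Unique; _∷_)
  open Membership setoid using (_∈_)

  ∉-tail : ∀ {x z xs} → All (z ≉_) xs → x ≈ z → x ∈ xs → ⊥
  ∉-tail ≉s x≈z x∈ = All[≉]⇒∉ setoid ≉s (∈-resp-≈ setoid x≈z x∈)

  index-≡⇔≈ : ∀ {x y xs} → Unique xs → (x∈ : x ∈ xs) (y∈ : y ∈ xs) → (index x∈ ≡ index y∈) ⇔ (x ≈ y)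
  index-≡⇔≈ u x∈ y∈ = mk⇔ (index-injective setoid x∈ y∈) (index-cong u x∈ y∈)
    where
    index-cong : ∀ {x y xs} → Unique xs → (x∈ : x ∈ xs) (y∈ : y ∈ xs) → x ≈ y → index x∈ ≡ index y∈
    index-cong _        (here _)   (here _)   _   = ≡.refl
    index-cong (_ ∷ u)  (there x∈) (there y∈) x≈y = ≡.cong suc (index-cong u x∈ y∈ x≈y)
    index-cong (≉s ∷ _) (here x≈z) (there y∈) x≈y = ⊥-elim (∉-tail ≉s (trans (sym x≈y) x≈z) y∈)
    index-cong (≉s ∷ _) (there x∈) (here y≈z) x≈y = ⊥-elim (∉-tail ≉s (trans x≈y y≈z) x∈)

  index-∈-lookup : ∀ xs i → index (∈-lookup setoid xs i) ≡ i
  index-∈-lookup (_ ∷ _)  zero    = ≡.refl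
  index-∈-lookup (_ ∷ xs) (suc i) = ≡.cong suc (index-∈-lookup xs i)

  count-≟-unique : ∀ {x xs} → Unique xs → x ∈ xs → count (x ≟_) xs ≡ 1
  count-≟-unique {x} (≉s ∷ _) (here x≈z) = ≡.trans (count-∷ (x ≟_) _ _)
    (≡.cong₂ _+_ (indicator-yes (x ≟ _) x≈z)
                 (≡.cong length (filter-none (x ≟_) (All.map (λ z≉w x≈w → z≉w (trans (sym x≈z) x≈w)) ≉s))))
  count-≟-unique {x} (≉s ∷ u) (there x∈) = ≡.trans (count-∷ (x ≟_) _ _)
    (≡.cong₂ _+_ (indicator-no (x ≟ _) (λ x≈z → ∉-tail ≉s x≈z x∈)) (count-≟-unique u x∈))

  module Transversal {q} {Q : Pred Carrier q} (Q? : Decidable Q) (xs : List Carrier) where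

    reps : List Carrier
    reps = deduplicate _≟_ (filter Q? xs)

    reps-unique : Unique reps
    reps-unique = deduplicate-! S (filter Q? xs)

    reps-Q : All Q reps
    reps-Q = Allₚ.deduplicate⁺ _≟_ (Allₚ.all-filter Q? xs)

    ∈-reps : ∀ {x} → x ∈ₚ xs → Q x → x ∈ reps
    ∈-reps x∈ Qx = ∈-deduplicate⁺ setoid _≟_ (λ y≈z x≈y → trans x≈y (sym y≈z))
                     (Any.map (λ { ≡.refl → refl }) (∈ₚ-filter⁺ Q? x∈ Qx))

    InClass : Carrier → Pred Carrier (q ⊔ ℓ)
    InClass r z = Q z × z ≈ r

    InClass? : ∀ r → Decidable (InClass r)
    InClass? r z = Q? z ×-dec (z ≟ r)

    count-classes : count Q? xs ≡ sum (map (λ r → count (InClass? r) xs) reps)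
    count-classes = count-partition Q? InClass? reps (All.tabulate in-one-class)
      where
      in-one-class : ∀ {x} → x ∈ₚ xs → count (λ r → InClass? r x) reps ≡ indicator (Q? x)
      in-one-class {x} x∈ with Q? x
      ... | yes Qx = ≡.trans
        (≡.cong length (filter-≐ _ (x ≟_) ((λ (_ , x≈r) → x≈r) , (λ x≈r → Qx , x≈r)) reps))
        (count-≟-unique reps-unique (∈-reps x∈ Qx))
      ... | no ¬Qx = ≡.cong length (filter-none _ (All.universal (λ _ (Qx , _) → ¬Qx Qx) reps))

module Cosets {c ℓ p} (G : FiniteGroup c ℓ) (H : Subgroup G p) where
  open FiniteGroup G
  open Subgroup H
  open import Algebra.Properties.Group group
    using (⁻¹-involutive; ⁻¹-anti-homo-∙; //-rightDividesˡ; //-rightDividesʳ; \\-leftDividesʳ)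
  open import Relation.Binary.Reasoning.Setoid setoid

  unsandwich : ∀ a b g → a ⁻¹ ∙ (a ∙ g ∙ b) ∙ b ⁻¹ ≈ g
  unsandwich a b g = begin
    a ⁻¹ ∙ (a ∙ g ∙ b) ∙ b ⁻¹  ≈⟨ ∙-congʳ (assoc (a ⁻¹) (a ∙ g) b) ⟨
    a ⁻¹ ∙ (a ∙ g) ∙ b ∙ b ⁻¹  ≈⟨ //-rightDividesʳ b _ ⟩
    a ⁻¹ ∙ (a ∙ g)             ≈⟨ \\-leftDividesʳ a g ⟩
    g                          ∎

  sandwich : ∀ a b g → a ∙ (a ⁻¹ ∙ g ∙ b ⁻¹) ∙ b ≈ g
  sandwich a b g = begin
    a ∙ (a ⁻¹ ∙ g ∙ b ⁻¹) ∙ b            ≈⟨ ∙-cong (∙-congʳ (⁻¹-involutive a)) (⁻¹-involutive b) ⟨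
    a ⁻¹ ⁻¹ ∙ (a ⁻¹ ∙ g ∙ b ⁻¹) ∙ b ⁻¹ ⁻¹ ≈⟨ unsandwich (a ⁻¹) (b ⁻¹) g ⟩
    g                                     ∎

  position : Carrier → Fin order
  position g = proj₁ (enum-surj g)

  enum-position : ∀ g → enum (position g) ≈ g
  enum-position g = proj₂ (enum-surj g)

  position-enum : ∀ {g i} → g ≈ enum i → position g ≡ i
  position-enum g≈ = enum-inj _ _ (trans (enum-position _) g≈)

  card-translate : ∀ {q r} {P : Pred Carrier q} {R : Pred Carrier r} (P? : Decidable P) (R? : Decidable R) →
                   P Respects _≈_ → ∀ a b → (λ g → P (a ∙ g ∙ b)) ≐ R → card G H P? ≡ card G H R?
  card-translate P? R? resp a b (to , from) = ≡.trans (count-permute (P? ∘ enum) π)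
    (≡.cong length (filter-≐ _ _ (to ∘ resp (enum-position _) , resp (sym (enum-position _)) ∘ from)
                                 (allFin order)))
    where
    σ τ : Fin order → Fin order
    σ i = position (a ∙ enum i ∙ b)
    τ i = position (a ⁻¹ ∙ enum i ∙ b ⁻¹)
    π : Permutation′ order
    π = permutation σ τ
      (λ i → position-enum (trans (∙-congʳ (∙-congˡ (enum-position _))) (sandwich a b _)))
      (λ i → position-enum (trans (∙-congʳ (∙-congˡ (enum-position _))) (unsandwich a b _)))

  infix 4 _≈ᴴ_ _≈ᴴᴴ_

  _≈ᴴ_ : Carrier → Carrier → Set p
  u ≈ᴴ v = (u ∙ v ⁻¹) ∈H

  ≈⇒≈ᴴ : ∀ {u v} → u ≈ v → u ≈ᴴ v
  ≈⇒≈ᴴ {u} u≈v = resp (sym (trans (∙-congˡ (⁻¹-cong (sym u≈v))) (inverseʳ u))) ε∈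

  ≈ᴴ-refl : ∀ {u} → u ≈ᴴ u
  ≈ᴴ-refl = ≈⇒≈ᴴ refl

  ≈ᴴ-sym : ∀ {u v} → u ≈ᴴ v → v ≈ᴴ u
  ≈ᴴ-sym {u} {v} uv = resp (trans (⁻¹-anti-homo-∙ u (v ⁻¹)) (∙-congʳ (⁻¹-involutive v))) (⁻¹-closed uv)

  ≈ᴴ-trans : ∀ {u v w} → u ≈ᴴ v → v ≈ᴴ w → u ≈ᴴ w
  ≈ᴴ-trans {u} {v} uv vw = resp (trans (sym (assoc _ _ _)) (∙-congʳ (//-rightDividesˡ v u))) (∙-closed uv vw)

  ∈H·-refl : ∀ g → _∈H·_ G H g g
  ∈H·-refl g = ε , ε∈ , sym (identityˡ g)

  ∈H·-resp-≈ᴴ : ∀ {u v z} → u ≈ᴴ v → _∈H·_ G H z u → _∈H·_ G H z v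
  ∈H·-resp-≈ᴴ {u} {v} uv (h , h∈ , z≈hu) = h ∙ (u ∙ v ⁻¹) , ∙-closed h∈ uv , (begin
    _                    ≈⟨ z≈hu ⟩
    h ∙ u                ≈⟨ ∙-congˡ (//-rightDividesˡ v u) ⟨
    h ∙ (u ∙ v ⁻¹ ∙ v)   ≈⟨ assoc _ _ _ ⟨
    h ∙ (u ∙ v ⁻¹) ∙ v   ∎)

  SameCoset⇔≈ᴴ : ∀ {u v} → SameCoset G H u v ⇔ u ≈ᴴ v
  SameCoset⇔≈ᴴ {u} {v} = mk⇔ same⇒≈ᴴ (λ uv z → mk⇔ (∈H·-resp-≈ᴴ uv) (∈H·-resp-≈ᴴ (≈ᴴ-sym uv)))
    where
    same⇒≈ᴴ : SameCoset G H u v → u ≈ᴴ v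
    same⇒≈ᴴ same with Equivalence.to (same u) (∈H·-refl u)
    ... | h , h∈ , u≈hv = resp (sym (trans (∙-congʳ u≈hv) (//-rightDividesʳ v h))) h∈

  _≈ᴴᴴ_ : Carrier → Carrier → Set (c ⊔ ℓ ⊔ p)
  a ≈ᴴᴴ b = _∈H·_·H G H b a

  ≈⇒≈ᴴᴴ : ∀ {a b} → a ≈ b → a ≈ᴴᴴ b
  ≈⇒≈ᴴᴴ {a} a≈b = ε , ε , ε∈ , ε∈ , sym (trans (identityʳ _) (trans (identityˡ a) a≈b))

  ≈ᴴᴴ-refl : ∀ {a} → a ≈ᴴᴴ a
  ≈ᴴᴴ-refl = ≈⇒≈ᴴᴴ refl

  ≈ᴴᴴ-sym : ∀ {a b} → a ≈ᴴᴴ b → b ≈ᴴᴴ a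
  ≈ᴴᴴ-sym {a} {b} (h₁ , h₂ , h₁∈ , h₂∈ , b≈) =
    h₁ ⁻¹ , h₂ ⁻¹ , ⁻¹-closed h₁∈ , ⁻¹-closed h₂∈ , sym (begin
    h₁ ⁻¹ ∙ b ∙ h₂ ⁻¹               ≈⟨ ∙-congʳ (∙-congˡ b≈) ⟩
    h₁ ⁻¹ ∙ (h₁ ∙ a ∙ h₂) ∙ h₂ ⁻¹   ≈⟨ unsandwich h₁ h₂ a ⟩
    a                               ∎)

  ≈ᴴᴴ-trans : ∀ {a b c} → a ≈ᴴᴴ b → b ≈ᴴᴴ c → a ≈ᴴᴴ c
  ≈ᴴᴴ-trans {a} {b} {c} (k₁ , k₂ , k₁∈ , k₂∈ , b≈) (h₁ , h₂ , h₁∈ , h₂∈ , c≈) =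
    h₁ ∙ k₁ , k₂ ∙ h₂ , ∙-closed h₁∈ k₁∈ , ∙-closed k₂∈ h₂∈ , (begin
    c                            ≈⟨ c≈ ⟩
    h₁ ∙ b ∙ h₂                  ≈⟨ ∙-congʳ (∙-congˡ b≈) ⟩
    h₁ ∙ (k₁ ∙ a ∙ k₂) ∙ h₂      ≈⟨ ∙-congʳ (∙-congˡ (assoc k₁ a k₂)) ⟩
    h₁ ∙ (k₁ ∙ (a ∙ k₂)) ∙ h₂    ≈⟨ ∙-congʳ (assoc h₁ k₁ (a ∙ k₂)) ⟨
    h₁ ∙ k₁ ∙ (a ∙ k₂) ∙ h₂      ≈⟨ assoc (h₁ ∙ k₁) (a ∙ k₂) h₂ ⟩
    h₁ ∙ k₁ ∙ (a ∙ k₂ ∙ h₂)      ≈⟨ ∙-congˡ (assoc a k₂ h₂) ⟩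
    h₁ ∙ k₁ ∙ (a ∙ (k₂ ∙ h₂))    ≈⟨ assoc (h₁ ∙ k₁) a (k₂ ∙ h₂) ⟨
    h₁ ∙ k₁ ∙ a ∙ (k₂ ∙ h₂)      ∎)

  ≈ᴴᴴ-⁻¹ : ∀ {a b} → a ≈ᴴᴴ b → a ⁻¹ ≈ᴴᴴ b ⁻¹
  ≈ᴴᴴ-⁻¹ {a} {b} (h₁ , h₂ , h₁∈ , h₂∈ , b≈) =
    h₂ ⁻¹ , h₁ ⁻¹ , ⁻¹-closed h₂∈ , ⁻¹-closed h₁∈ , (begin
    b ⁻¹                     ≈⟨ ⁻¹-cong b≈ ⟩
    (h₁ ∙ a ∙ h₂) ⁻¹         ≈⟨ ⁻¹-anti-homo-∙ (h₁ ∙ a) h₂ ⟩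
    h₂ ⁻¹ ∙ (h₁ ∙ a) ⁻¹      ≈⟨ ∙-congˡ (⁻¹-anti-homo-∙ h₁ a) ⟩
    h₂ ⁻¹ ∙ (a ⁻¹ ∙ h₁ ⁻¹)   ≈⟨ assoc _ _ _ ⟨
    h₂ ⁻¹ ∙ a ⁻¹ ∙ h₁ ⁻¹     ∎)

  ∈H·⇒≈ᴴᴴ : ∀ {g z} → _∈H·_ G H z g → g ≈ᴴᴴ z
  ∈H·⇒≈ᴴᴴ {g} (h , h∈ , z≈hg) = h , ε , h∈ , ε∈ , trans z≈hg (sym (identityʳ _))

  ≈ᴴ⇒≈ᴴᴴ : ∀ {g g'} → g ≈ᴴ g' → g ≈ᴴᴴ g'
  ≈ᴴ⇒≈ᴴᴴ {g} {g'} gg' =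
    ∈H·⇒≈ᴴᴴ (Equivalence.from (Equivalence.from SameCoset⇔≈ᴴ gg' g') (∈H·-refl g'))

  ⁻¹≈ᴴᴴ-resp : ∀ {a b g g'} → a ≈ᴴᴴ g → b ≈ᴴᴴ g' → (g ⁻¹ ≈ᴴᴴ g') ⇔ (a ⁻¹ ≈ᴴᴴ b)
  ⁻¹≈ᴴᴴ-resp ag bg' = mk⇔
    (λ e → ≈ᴴᴴ-trans (≈ᴴᴴ-⁻¹ ag) (≈ᴴᴴ-trans e (≈ᴴᴴ-sym bg')))
    (λ e → ≈ᴴᴴ-trans (≈ᴴᴴ-sym (≈ᴴᴴ-⁻¹ ag)) (≈ᴴᴴ-trans e bg'))

  ≈ᴴᴴ⇒∃≈ᴴ∙ : ∀ {a g} → a ≈ᴴᴴ g → ∃[ h ] (h ∈H × g ≈ᴴ a ∙ h)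
  ≈ᴴᴴ⇒∃≈ᴴ∙ {a} {g} (h₁ , h₂ , h₁∈ , h₂∈ , g≈) = h₂ , h₂∈ , resp (sym (begin
    g ∙ (a ∙ h₂) ⁻¹               ≈⟨ ∙-congʳ g≈ ⟩
    h₁ ∙ a ∙ h₂ ∙ (a ∙ h₂) ⁻¹     ≈⟨ ∙-congʳ (assoc h₁ a h₂) ⟩
    h₁ ∙ (a ∙ h₂) ∙ (a ∙ h₂) ⁻¹   ≈⟨ //-rightDividesʳ (a ∙ h₂) h₁ ⟩
    h₁                            ∎)) h₁∈

  SameDouble⇔≈ᴴᴴ : ∀ {a b} → SameDouble G H a b ⇔ a ≈ᴴᴴ b
  SameDouble⇔≈ᴴᴴ {a} {b} = mk⇔
    (λ same → ≈ᴴᴴ-sym (Equivalence.to (same a) ≈ᴴᴴ-refl))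
    (λ ab z → mk⇔ (≈ᴴᴴ-trans (≈ᴴᴴ-sym ab)) (≈ᴴᴴ-trans ab))

  ≈ᴴᴴ-∙ʳ : ∀ {a h} → h ∈H → a ≈ᴴᴴ a ∙ h
  ≈ᴴᴴ-∙ʳ {a} h∈ = ε , _ , ε∈ , h∈ , sym (∙-congʳ (identityˡ a))

  ∣H∩H^⁻¹∣ : ∀ x → ∣H∩H^_∣ G H (x ⁻¹) ≡ ∣H∩H^_∣ G H x
  ∣H∩H^⁻¹∣ x = card-translate
    (λ g → dec g ×-dec dec (x ⁻¹ ∙ g ∙ x ⁻¹ ⁻¹)) (λ g → dec g ×-dec dec (x ∙ g ∙ x ⁻¹))
    (λ g≈ (g∈ , gx∈) → resp g≈ g∈ , resp (∙-congʳ (∙-congˡ g≈)) gx∈) x (x ⁻¹)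
    ((λ (gx∈ , g∈) → resp (unsandwich x (x ⁻¹) _) g∈ , gx∈) ,
     (λ (g∈ , gx∈) → gx∈ , resp (sym (unsandwich x (x ⁻¹) _)) g∈))

  record RightCosetIndexing (y : Carrier) (m : ℕ) : Set (c ⊔ ℓ ⊔ p) where
    field
      label            : ∀ {g} → y ≈ᴴᴴ g → Fin m
      label-≡⇔≈ᴴ       : ∀ {g g'} (d : y ≈ᴴᴴ g) (d' : y ≈ᴴᴴ g') → (label d ≡ label d') ⇔ (g ≈ᴴ g')
      label-surjective : ∀ i → ∃[ g ] Σ (y ≈ᴴᴴ g) λ d → label d ≡ i

    label-irrelevant : ∀ {g} (d d' : y ≈ᴴᴴ g) → label d ≡ label d'
    label-irrelevant d d' = Equivalence.from (label-≡⇔≈ᴴ d d') ≈ᴴ-refl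

  module CosetsInDoubleCoset (y : Carrier) where

    -- On H its classes are the right cosets Hyh ⊆ HyH, each of size |H ∩ H^y|.
    sameRightCosetAfter : DecSetoid 0ℓ p
    sameRightCosetAfter = record
      { Carrier          = Fin order
      ; _≈_              = λ i j → y ∙ enum i ≈ᴴ y ∙ enum j
      ; isDecEquivalence = record
        { isEquivalence = record { refl = ≈ᴴ-refl ; sym = ≈ᴴ-sym ; trans = ≈ᴴ-trans }
        ; _≟_           = λ i j → dec _
        }
      }

    open DecSetoid sameRightCosetAfter using () renaming (setoid to setoidᵢ)
    open Membership setoidᵢ using (_∈_)
    open Transversal sameRightCosetAfter (dec ∘ enum) (allFin order) public

    conj-∙ʳ : ∀ g s → y ∙ (g ∙ s) ∙ (y ∙ s) ⁻¹ ≈ y ∙ g ∙ y ⁻¹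
    conj-∙ʳ g s = begin
      y ∙ (g ∙ s) ∙ (y ∙ s) ⁻¹      ≈⟨ ∙-cong (sym (assoc y g s)) (⁻¹-anti-homo-∙ y s) ⟩
      y ∙ g ∙ s ∙ (s ⁻¹ ∙ y ⁻¹)     ≈⟨ assoc _ _ _ ⟨
      y ∙ g ∙ s ∙ s ⁻¹ ∙ y ⁻¹       ≈⟨ ∙-congʳ (//-rightDividesʳ s (y ∙ g)) ⟩
      y ∙ g ∙ y ⁻¹                  ∎

    class-size : ∀ {r} → enum r ∈H → count (InClass? r) (allFin order) ≡ ∣H∩H^_∣ G H y
    class-size {r} r∈ = card-translate
      (λ g → dec g ×-dec dec (y ∙ g ∙ (y ∙ s) ⁻¹)) (λ g → dec g ×-dec dec (y ∙ g ∙ y ⁻¹))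
      (λ g≈ (g∈ , e) → resp g≈ g∈ , resp (∙-congʳ (∙-congˡ g≈)) e) ε s
      ((λ (h∈ , e) → resp (//-rightDividesʳ s _) (∙-closed (resp εgs≈ h∈) (⁻¹-closed r∈)) ,
                     resp (conj-∙ʳ _ s) (resp (∙-congʳ (∙-congˡ εgs≈)) e)) ,
       (λ (g∈ , k) → resp (sym εgs≈) (∙-closed g∈ r∈) ,
                     resp (sym (trans (∙-congʳ (∙-congˡ εgs≈)) (conj-∙ʳ _ s))) k))
      where
      s = enum r
      εgs≈ : ∀ {g} → ε ∙ g ∙ s ≈ g ∙ s
      εgs≈ = ∙-congʳ (identityˡ _)

    ∣H∣≡#classes*∣H∩H^y∣ : ∣H∣ G H ≡ length reps * ∣H∩H^_∣ G H y
    ∣H∣≡#classes*∣H∩H^y∣ = ≡.trans count-classes (sum-map-const _ (All.map class-size reps-Q))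

    ∣H∩H^y∣>0 : 0 < ∣H∩H^_∣ G H y
    ∣H∩H^y∣>0 = filter-some _
      (Any.map (λ { ≡.refl → resp (sym (enum-position ε)) ε∈ , resp yεy⁻¹≈ε ε∈ }) (∈ₚ-allFin (position ε)))
      where
      yεy⁻¹≈ε : ε ≈ y ∙ enum (position ε) ∙ y ⁻¹
      yεy⁻¹≈ε = sym (trans (∙-congʳ (trans (∙-congˡ (enum-position ε)) (identityʳ y))) (inverseʳ y))

    rep : ∀ {g} → y ≈ᴴᴴ g → Fin order
    rep d = position (proj₁ (≈ᴴᴴ⇒∃≈ᴴ∙ d))

    rep∈H : ∀ {g} (d : y ≈ᴴᴴ g) → enum (rep d) ∈H
    rep∈H d = resp (sym (enum-position _)) (proj₁ (proj₂ (≈ᴴᴴ⇒∃≈ᴴ∙ d)))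

    ≈ᴴ-rep : ∀ {g} (d : y ≈ᴴᴴ g) → g ≈ᴴ y ∙ enum (rep d)
    ≈ᴴ-rep d = ≈ᴴ-trans (proj₂ (proj₂ (≈ᴴᴴ⇒∃≈ᴴ∙ d))) (≈⇒≈ᴴ (∙-congˡ (sym (enum-position _))))

    rep∈reps : ∀ {g} (d : y ≈ᴴᴴ g) → rep d ∈ reps
    rep∈reps d = ∈-reps (∈ₚ-allFin _) (rep∈H d)

    label : ∀ {g} → y ≈ᴴᴴ g → Fin (length reps)
    label d = index (rep∈reps d)

    label-≡⇔≈ᴴ : ∀ {g g'} (d : y ≈ᴴᴴ g) (d' : y ≈ᴴᴴ g') → (label d ≡ label d') ⇔ (g ≈ᴴ g')
    label-≡⇔≈ᴴ d d' = mk⇔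
      (λ eq → ≈ᴴ-trans (≈ᴴ-rep d) (≈ᴴ-trans (to eq) (≈ᴴ-sym (≈ᴴ-rep d'))))
      (λ gg' → from (≈ᴴ-trans (≈ᴴ-sym (≈ᴴ-rep d)) (≈ᴴ-trans gg' (≈ᴴ-rep d'))))
      where open Equivalence (index-≡⇔≈ sameRightCosetAfter reps-unique (rep∈reps d) (rep∈reps d'))

    label-surjective : ∀ i → ∃[ g ] Σ (y ≈ᴴᴴ g) λ d → label d ≡ i
    label-surjective i = _ , d , ≡.trans
      (Equivalence.from (index-≡⇔≈ sameRightCosetAfter reps-unique (rep∈reps d) (∈-lookup setoidᵢ reps i))
                        (≈ᴴ-sym (≈ᴴ-rep d)))
      (index-∈-lookup sameRightCosetAfter reps i)
      where
      d = ≈ᴴᴴ-∙ʳ (All.lookup reps-Q (∈ₚ-lookup i))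

  rightCosetIndexing : ∀ y m → m * ∣H∩H^_∣ G H y ≡ ∣H∣ G H → RightCosetIndexing y m
  rightCosetIndexing y m m*∣H∩H^y∣≡∣H∣ = ≡.subst (RightCosetIndexing y) #classes≡m
    (record { label = label ; label-≡⇔≈ᴴ = label-≡⇔≈ᴴ ; label-surjective = label-surjective })
    where
    open CosetsInDoubleCoset y
    #classes≡m : length reps ≡ m
    #classes≡m = *-cancelʳ-≡ _ m (∣H∩H^_∣ G H y) {{>-nonZero ∣H∩H^y∣>0}}
                   (≡.trans (≡.sym ∣H∣≡#classes*∣H∩H^y∣) (≡.sym m*∣H∩H^y∣≡∣H∣))

  module _ (x : Carrier) where

    doubleCoset : (u : VertΓ G H x) → x ≈ᴴᴴ proj₁ u ⊎ x ⁻¹ ≈ᴴᴴ proj₁ u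
    doubleCoset (g , Hg⊆) = Hg⊆ g (∈H·-refl g)

    vertex : ∀ {g} → x ≈ᴴᴴ g ⊎ x ⁻¹ ≈ᴴᴴ g → VertΓ G H x
    vertex {g} d = g , λ z z∈Hg → let g≈ᴴᴴz = ∈H·⇒≈ᴴᴴ z∈Hg in
      Sum.map (λ d → ≈ᴴᴴ-trans d g≈ᴴᴴz) (λ d → ≈ᴴᴴ-trans d g≈ᴴᴴz) d

    Γₓ≅Kₘ : ∀ {m} → RightCosetIndexing x m → x ⁻¹ ≈ᴴᴴ x → Γ_≅_ G H x (Fin m) (AdjK m)
    Γₓ≅Kₘ {m} I x⁻¹≈ᴴᴴx = record
      { f       = λ u → label (inHxH u)
      ; f-class = label-≡⇔SameCoset
      ; f-surj  = λ i → let (_ , d , ld≡i) = label-surjective i in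
                  vertex (inj₁ d) , ≡.trans (label-irrelevant _ d) ld≡i
      ; f-adj   = λ u v → mk⇔
          (λ (¬same , _) → ¬same ∘ Equivalence.to (label-≡⇔SameCoset u v))
          (λ ≢ → ≢ ∘ Equivalence.from (label-≡⇔SameCoset u v) ,
                 Equivalence.from (⁻¹≈ᴴᴴ-resp (inHxH u) (inHxH v)) x⁻¹≈ᴴᴴx)
      }
      where
      open RightCosetIndexing I
      inHxH : (u : VertΓ G H x) → x ≈ᴴᴴ proj₁ u
      inHxH u = [ id , ≈ᴴᴴ-trans (≈ᴴᴴ-sym x⁻¹≈ᴴᴴx) ]′ (doubleCoset u)
      label-≡⇔SameCoset : ∀ u v → (label (inHxH u) ≡ label (inHxH v)) ⇔ SameCoset G H (proj₁ u) (proj₁ v)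
      label-≡⇔SameCoset u v = ⇔-sym SameCoset⇔≈ᴴ ⇔-∘ label-≡⇔≈ᴴ (inHxH u) (inHxH v)

    Γₓ≅Kₘₘ : ∀ {m} → RightCosetIndexing x m → RightCosetIndexing (x ⁻¹) m → ¬ (x ⁻¹ ≈ᴴᴴ x) →
             Γ_≅_ G H x (Fin m ⊎ Fin m) (AdjKmm m)
    Γₓ≅Kₘₘ {m} I J x⁻¹≉ᴴᴴx = record
      { f       = λ u → label (doubleCoset u)
      ; f-class = λ u v → ⇔-sym SameCoset⇔≈ᴴ ⇔-∘ label-≡⇔≈ᴴ (doubleCoset u) (doubleCoset v)
      ; f-surj  = surjective
      ; f-adj   = λ u v → adjacent (doubleCoset u) (doubleCoset v)
      }
      where
      module I = RightCosetIndexing I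
      module J = RightCosetIndexing J
      open Equivalence using (to; from)

      Side : Carrier → Set (c ⊔ ℓ ⊔ p)
      Side g = x ≈ᴴᴴ g ⊎ x ⁻¹ ≈ᴴᴴ g

      x⁻¹⁻¹≈ᴴᴴx : x ⁻¹ ⁻¹ ≈ᴴᴴ x
      x⁻¹⁻¹≈ᴴᴴx = ≈⇒≈ᴴᴴ (⁻¹-involutive x)

      disjoint : ∀ {g} → x ≈ᴴᴴ g → x ⁻¹ ≈ᴴᴴ g → ⊥
      disjoint d d' = x⁻¹≉ᴴᴴx (≈ᴴᴴ-trans d' (≈ᴴᴴ-sym d))

      label : ∀ {g} → Side g → Fin m ⊎ Fin m
      label = Sum.map I.label J.label

      label-≡⇔≈ᴴ : ∀ {g g'} (s : Side g) (s' : Side g') → (label s ≡ label s') ⇔ (g ≈ᴴ g')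
      label-≡⇔≈ᴴ (inj₁ d) (inj₁ d') = I.label-≡⇔≈ᴴ d d' ⇔-∘ mk⇔ inj₁-injective (≡.cong inj₁)
      label-≡⇔≈ᴴ (inj₂ d) (inj₂ d') = J.label-≡⇔≈ᴴ d d' ⇔-∘ mk⇔ inj₂-injective (≡.cong inj₂)
      label-≡⇔≈ᴴ (inj₁ d) (inj₂ d') = mk⇔ (λ ()) λ gg' → ⊥-elim (disjoint (≈ᴴᴴ-trans d (≈ᴴ⇒≈ᴴᴴ gg')) d')
      label-≡⇔≈ᴴ (inj₂ d) (inj₁ d') = mk⇔ (λ ()) λ gg' → ⊥-elim (disjoint d' (≈ᴴᴴ-trans d (≈ᴴ⇒≈ᴴᴴ gg')))

      surjective : ∀ t → ∃[ u ] (label (doubleCoset u) ≡ t)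
      surjective (inj₁ i) = let (_ , d , ld≡i) = I.label-surjective i in
        vertex (inj₁ d) , ≡.cong inj₁ (≡.trans (I.label-irrelevant _ d) ld≡i)
      surjective (inj₂ i) = let (_ , d , ld≡i) = J.label-surjective i in
        vertex (inj₂ d) , ≡.cong inj₂ (≡.trans (J.label-irrelevant _ d) ld≡i)

      distinct : ∀ {g g'} (s : Side g) (s' : Side g') → ¬ label s ≡ label s' → ¬ SameCoset G H g g'
      distinct s s' ≢ = ≢ ∘ Equivalence.from (label-≡⇔≈ᴴ s s') ∘ Equivalence.to SameCoset⇔≈ᴴ

      adjacent : ∀ {g g'} (s : Side g) (s' : Side g') → Adj G H g g' ⇔ AdjKmm m (label s) (label s')
      adjacent (inj₁ d) (inj₁ d') = mk⇔ (λ (_ , e) → x⁻¹≉ᴴᴴx (to (⁻¹≈ᴴᴴ-resp d d') e)) λ ()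
      adjacent (inj₂ d) (inj₂ d') = mk⇔
        (λ (_ , e) → x⁻¹≉ᴴᴴx (≈ᴴᴴ-sym (≈ᴴᴴ-trans (≈ᴴᴴ-sym x⁻¹⁻¹≈ᴴᴴx) (to (⁻¹≈ᴴᴴ-resp d d') e)))) λ ()
      adjacent (inj₁ d) (inj₂ d') = mk⇔ _ λ _ →
        distinct (inj₁ d) (inj₂ d') (λ ()) , from (⁻¹≈ᴴᴴ-resp d d') ≈ᴴᴴ-refl
      adjacent (inj₂ d) (inj₁ d') = mk⇔ _ λ _ →
        distinct (inj₂ d) (inj₁ d') (λ ()) , from (⁻¹≈ᴴᴴ-resp d d') x⁻¹⁻¹≈ᴴᴴx

lemma2p1 : ∀ {c ℓ p} (G : FiniteGroup c ℓ) (H : Subgroup G p) (x : FiniteGroup.Carrier G)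
           (m : ℕ) → m * ∣H∩H^_∣ G H x ≡ ∣H∣ G H →
           (SameDouble G H x (FiniteGroup._⁻¹ G x) → Γ_≅_ G H x (Fin m) (AdjK m))
           × (¬ SameDouble G H x (FiniteGroup._⁻¹ G x) → Γ_≅_ G H x (Fin m ⊎ Fin m) (AdjKmm m))
lemma2p1 G H x m m*∣H∩H^x∣≡∣H∣ =
  (λ same → Γₓ≅Kₘ x Iₓ (≈ᴴᴴ-sym (to same))) ,
  (λ ¬same → Γₓ≅Kₘₘ x Iₓ Iₓ⁻¹ (¬same ∘ from ∘ ≈ᴴᴴ-sym))
  where
  open FiniteGroup G using (_⁻¹)
  open Cosets G H
  open Equivalence SameDouble⇔≈ᴴᴴ
  Iₓ : RightCosetIndexing x m
  Iₓ = rightCosetIndexing x m m*∣H∩H^x∣≡∣H∣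
  Iₓ⁻¹ : RightCosetIndexing (x ⁻¹) m
  Iₓ⁻¹ = rightCosetIndexing (x ⁻¹) m (≡.trans (≡.cong (m *_) (∣H∩H^⁻¹∣ x)) m*∣H∩H^x∣≡∣H∣)
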